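{- Let $G$ be a finite graph, $L$ a degree-assignment for $G$, and $vw$ an edge of $G$ such that $G-vw$ is connected and degree-choosable. If $|L(v)\cap L(w)|\le 1$, then $G$ is $L$-swappable.
   Context: A list-assignment $L$ assigns to each vertex $v$ a set $L(v)$ of colors; it is a degree-assignment (for $G$) if $|L(v)|=d_G(v)$ for all $v$. An $L$-coloring is a proper coloring $\varphi$ with $\varphi(v)\in L(v)$. A graph is degree-choosable if it has an $L$-coloring for every degree-assignment $L$ (of that graph). An $\alpha,\beta$-Kempe swap at a vertex $u$ with $\varphi(u)\in\{\alpha,\beta\}$ interchanges $\alpha$ and $\beta$ on the component containing $u$ of the subgraph induced by vertices colored $\alpha$ or $\beta$; it is $L$-valid if the result is again an $L$-coloring. Two $L$-colorings are $L$-equivalent if one is obtained from the other by a sequence of $L$-valid Kempe swaps. $G$ is $L$-swappable if it has an $L$-coloring and all its $L$-colorings are pairwise $L$-equivalent. -}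

module Defs where

import Data.Nat
open import Data.Nat using (ℕ; _≤_)
open import Data.Fin using (Fin)
open import Data.Bool using (Bool; true; false; T; _∧_; _∨_; not; if_then_else_)
open import Data.Bool.Properties using (T?)
open import Data.List using (List; length; filter)
open import Data.List.Membership.Propositional using (_∈_)
open import Data.List.Membership.DecPropositional Data.Nat._≟_ using (_∈?_)
open import Data.List.Relation.Unary.Unique.Propositional using (Unique)
open import Data.Fin using () renaming (_≟_ to _≟F_)
open import Data.List using (allFin)
open import Data.List using () renaming (map to lmap)
open import Data.Product using (Σ; ∃; _×_; _,_)
open import Data.Sum using (_⊎_)
open import Relation.Nullary using (¬_)
open import Relation.Nullary.Decidable using (⌊_⌋)
open import Relation.Binary.PropositionalEquality using (_≡_; _≢_)
open import Relation.Binary.Construct.Closure.ReflexiveTransitive using (Star)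

Adj : ℕ → Set
Adj n = Fin n → Fin n → Bool

IsSimple : {n : ℕ} → Adj n → Set
IsSimple {n} G = (∀ x y → G x y ≡ G y x) × (∀ x → G x x ≡ false)

Colour : Set
Colour = ℕ

degree : {n : ℕ} → Adj n → Fin n → ℕ
degree {n} G x = length (filter (λ y → T? (G x y)) (allFin n))

-- A list-assignment: each vertex gets a finite set of colours (a duplicate-free list).
ListAssignment : ℕ → Set
ListAssignment n = Fin n → List Colour

IsDegreeAssignment : {n : ℕ} → Adj n → ListAssignment n → Set
IsDegreeAssignment G L = ∀ x → Unique (L x) × (length (L x) ≡ degree G x)

Colouring : ℕ → Set
Colouring n = Fin n → Colour

IsLColouring : {n : ℕ} → Adj n → ListAssignment n → Colouring n → Set
IsLColouring G L φ = (∀ x y → T (G x y) → φ x ≢ φ y) × (∀ x → φ x ∈ L x)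

deleteEdge : {n : ℕ} → Adj n → Fin n → Fin n → Adj n
deleteEdge G v w x y =
  G x y ∧ not ((⌊ x ≟F v ⌋ ∧ ⌊ y ≟F w ⌋) ∨ (⌊ x ≟F w ⌋ ∧ ⌊ y ≟F v ⌋))

data Reach {n : ℕ} (G : Adj n) (x : Fin n) : Fin n → Set where
  here : Reach G x x
  step : ∀ {y z} → Reach G x y → T (G y z) → Reach G x z

Connected : {n : ℕ} → Adj n → Set
Connected G = ∀ x y → Reach G x y

DegreeChoosable : {n : ℕ} → Adj n → Set
DegreeChoosable G =
  ∀ (L : ListAssignment _) → IsDegreeAssignment G L → ∃ λ φ → IsLColouring G L φ

_∈₂_,_ : Colour → Colour → Colour → Set
c ∈₂ α , β = c ≡ α ⊎ c ≡ β

KempeSub : {n : ℕ} → Adj n → Colouring n → Colour → Colour → Adj n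
KempeSub G φ α β x y =
  G x y ∧ (⌊ φ x Data.Nat.≟ α ⌋ ∨ ⌊ φ x Data.Nat.≟ β ⌋)
        ∧ (⌊ φ y Data.Nat.≟ α ⌋ ∨ ⌊ φ y Data.Nat.≟ β ⌋)

swapCol : Colour → Colour → Colour → Colour
swapCol α β c = if ⌊ c Data.Nat.≟ α ⌋ then β else (if ⌊ c Data.Nat.≟ β ⌋ then α else c)

KempeSwapAt : {n : ℕ} → Adj n → Colouring n → Fin n → Colour → Colour → Colouring n → Set
KempeSwapAt G φ u α β ψ =
  (φ u ∈₂ α , β) ×
  (∀ x → (Reach (KempeSub G φ α β) u x → ψ x ≡ swapCol α β (φ x))
       × (¬ Reach (KempeSub G φ α β) u x → ψ x ≡ φ x))

LValidSwap : {n : ℕ} → Adj n → ListAssignment n → Colouring n → Colouring n → Set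
LValidSwap G L φ ψ =
  IsLColouring G L φ × IsLColouring G L ψ ×
  (∃ λ u → ∃ λ α → ∃ λ β → KempeSwapAt G φ u α β ψ)

LEquivalent : {n : ℕ} → Adj n → ListAssignment n → Colouring n → Colouring n → Set
LEquivalent G L = Star (LValidSwap G L)

LSwappable : {n : ℕ} → Adj n → ListAssignment n → Set
LSwappable G L =
  (∃ λ φ → IsLColouring G L φ) ×
  (∀ φ ψ → IsLColouring G L φ → IsLColouring G L ψ → LEquivalent G L φ ψ)

∣_∩_∣ : List Colour → List Colour → ℕ
∣ A ∩ B ∣ = length (filter (λ c → c ∈? B) A)

{-# OPTIONS --safe #-}
-- Since |L v ∩ L w| ≤ 1 and φ v ≠ φ w, every L-colouring φ has φ v ∉ L w or φ w ∉ L v.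
-- Colourings of the first kind are exactly the M-colourings for M := L with L w removed from
-- L v.  In M the lists of v and w are disjoint, so the edge vw is irrelevant to how crowded
-- a vertex is, and M is degenerate: every nonempty vertex set S contains a vertex x with
-- fewer neighbours in S sharing a colour with x than |M x| (a vertex with a neighbour
-- outside S in the connected graph G - vw, or w itself when S is everything, since w lost
-- the edge vw but kept d(w) colours).  For degenerate lists all colourings are Kempe
-- equivalent, by induction on S: delete x, connect the restricted colourings, lift each swap
-- back to S (recolouring x beforehand, or letting the chain absorb x; sparseness of x is
-- what makes one of the two possible) and recolour x at the end.  The same holds with v and
-- w exchanged, and degree-choosability of G - vw on lists pruned at both ends produces a
-- colouring of both kinds, which links the two classes.
module Submission where

open import Defs
open import Data.Bool using (Bool; true; T; _∧_; _∨_; not; if_then_else_)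
open import Data.Bool.Properties using (T?; T-∧; T-∨; ∧-comm; ∨-comm)
open import Data.Empty using (⊥; ⊥-elim)
open import Data.Fin using (Fin) renaming (_≟_ to _≟F_)
import Data.Fin.Properties as FinP
open import Data.List using (List; []; _∷_; length; filter; map; take; allFin)
open import Data.List.Properties using (filter-none; filter-notAll; length-map; length-take)
open import Data.List.Membership.Propositional using (_∈_; _∉_; find)
open import Data.List.Membership.Propositional.Properties using (∈-filter⁺; ∈-filter⁻; ∈-map⁺; ∈-allFin)
import Data.List.Relation.Unary.All as All
open import Data.List.Relation.Unary.Any as Any using (Any; here; there; any?)
open import Data.List.Relation.Unary.Unique.Propositional using (Unique; []; _∷_)
open import Data.List.Relation.Unary.Unique.Propositional.Properties using (filter⁺; take⁺)
open import Data.List.Relation.Binary.Sublist.Propositional using (⊆-refl; lookup)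
open import Data.List.Relation.Binary.Sublist.Propositional.Properties as Sublist using (length-mono-≤; take-⊆)
open import Data.Nat using (ℕ; zero; suc; _≤_; _<_; _+_; z≤n; s≤s) renaming (_≟_ to _≟ℕ_)
open import Data.Nat.Properties
  using (≤-refl; ≤-trans; ≤-reflexive; ≤-pred; ≤-<-trans; <-≤-trans; n≮n; n≮0; m≤n⇒m≤1+n; m≤n⇒m⊓n≡m;
         +-suc; +-monoˡ-≤; module ≤-Reasoning)
open import Data.List.Membership.DecPropositional _≟ℕ_ using (_∈?_)
open import Data.Product as Product using (∃; _×_; _,_; proj₁; proj₂)
open import Data.Sum as Sum using (_⊎_; inj₁; inj₂; [_,_])
open import Function using (_∘_; id)
open import Function.Bundles using (module Equivalence)
open import Level using (0ℓ)
open import Relation.Binary.Construct.Closure.ReflexiveTransitive as Star using (Star; ε; _◅_; _◅◅_)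
open import Relation.Binary.Definitions using (DecidableEquality)
open import Relation.Binary.PropositionalEquality
  using (_≡_; _≢_; refl; sym; trans; cong; cong₂; subst; module ≡-Reasoning)
open import Relation.Nullary using (¬_; Dec; yes; no; ¬?; _⊎-dec_; _×-dec_; _→-dec_)
open import Relation.Nullary.Decidable
  using (⌊_⌋; decidable-stable; toWitness; fromWitness; toWitnessFalse; fromWitnessFalse)
open import Relation.Unary using (Pred; Decidable)

T-∧⁻ : ∀ a {b} → T (a ∧ b) → T a × T b
T-∧⁻ a = Equivalence.to (T-∧ {a})

T-∧⁺ : ∀ {a b} → T a → T b → T (a ∧ b)
T-∧⁺ {a} ta tb = Equivalence.from (T-∧ {a}) (ta , tb)

∈₂-reflects : ∀ {c α β} → T (⌊ c ≟ℕ α ⌋ ∨ ⌊ c ≟ℕ β ⌋) → c ∈₂ α , β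
∈₂-reflects {c} {α} t = Sum.map toWitness toWitness (Equivalence.to (T-∨ {⌊ c ≟ℕ α ⌋}) t)

∈₂-reflected : ∀ {c α β} → c ∈₂ α , β → T (⌊ c ≟ℕ α ⌋ ∨ ⌊ c ≟ℕ β ⌋)
∈₂-reflected {c} {α} c∈ = Equivalence.from (T-∨ {⌊ c ≟ℕ α ⌋}) (Sum.map fromWitness fromWitness c∈)

∈₂? : ∀ c α β → Dec (c ∈₂ α , β)
∈₂? c α β = (c ≟ℕ α) ⊎-dec (c ≟ℕ β)

swapCol-α : ∀ α β → swapCol α β α ≡ β
swapCol-α α β with α ≟ℕ α
... | yes _ = refl
... | no α≢α = ⊥-elim (α≢α refl)

swapCol-same : ∀ α c → swapCol α α c ≡ c
swapCol-same α c with c ≟ℕ α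
... | yes c≡α = sym c≡α
... | no _ = refl

swapCol-∈₂ : ∀ {α β c} → c ∈₂ α , β → swapCol α β c ∈₂ α , β
swapCol-∈₂ {α} {β} {c} c∈ with c ≟ℕ α
... | yes _ = inj₂ refl
... | no _ with c ≟ℕ β
...   | yes _ = inj₁ refl
...   | no _ = c∈

swapCol-involutive : ∀ {α β c} → c ∈₂ α , β → swapCol α β (swapCol α β c) ≡ c
swapCol-involutive {α} {β} {c} c∈ with c ≟ℕ α
... | yes c≡α = back
  where
  back : swapCol α β β ≡ c
  back with β ≟ℕ α
  ... | yes β≡α = trans β≡α (sym c≡α)
  ... | no _ with β ≟ℕ β
  ...   | yes _ = sym c≡α
  ...   | no β≢β = ⊥-elim (β≢β refl)
... | no c≢α with c ≟ℕ β
...   | yes c≡β = trans (swapCol-α α β) (sym c≡β)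
...   | no c≢β = ⊥-elim ([ c≢α , c≢β ] c∈)

swapCol-other : ∀ {α β c γ} → c ∈₂ α , β → γ ∈₂ α , β → c ≢ γ → c ≡ swapCol α β γ
swapCol-other {α} {β} {c} {γ} c∈ γ∈ c≢γ with γ ≟ℕ α
... | yes γ≡α = [ (λ c≡α → ⊥-elim (c≢γ (trans c≡α (sym γ≡α)))) , id ] c∈
... | no γ≢α with γ ≟ℕ β
...   | yes γ≡β = [ id , (λ c≡β → ⊥-elim (c≢γ (trans c≡β (sym γ≡β)))) ] c∈
...   | no γ≢β = ⊥-elim ([ γ≢α , γ≢β ] γ∈)

module _ {A : Set} {P Q : Pred A 0ℓ} (P? : Decidable P) (Q? : Decidable Q) (P⇒Q : ∀ {z} → P z → Q z) where

  length-filter-mono : ∀ xs → length (filter P? xs) ≤ length (filter Q? xs)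
  length-filter-mono xs = length-mono-≤ (Sublist.filter⁺ P? Q? (λ { refl → P⇒Q }) (⊆-refl {x = xs}))

  length-filter-mono-< : ∀ {xs y} → y ∈ xs → Q y → ¬ P y → length (filter P? xs) < length (filter Q? xs)
  length-filter-mono-< {x ∷ xs} (here refl) qx ¬px with P? x | Q? x
  ... | yes px | _ = ⊥-elim (¬px px)
  ... | no _ | no ¬qx = ⊥-elim (¬qx qx)
  ... | no _ | yes _ = s≤s (length-filter-mono xs)
  length-filter-mono-< {x ∷ xs} (there y∈) qy ¬py with P? x | Q? x
  ... | yes _ | yes _ = s≤s (length-filter-mono-< y∈ qy ¬py)
  ... | no _ | yes _ = m≤n⇒m≤1+n (length-filter-mono-< y∈ qy ¬py)
  ... | no _ | no _ = length-filter-mono-< y∈ qy ¬py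
  ... | yes px | no ¬qx = ⊥-elim (¬qx (P⇒Q px))

module _ {A : Set} {P : Pred A 0ℓ} (P? : Decidable P) where

  length-filter-split : ∀ xs → length (filter P? xs) + length (filter (¬? ∘ P?) xs) ≡ length xs
  length-filter-split [] = refl
  length-filter-split (x ∷ xs) with P? x
  ... | yes _ = cong suc (length-filter-split xs)
  ... | no _ = trans (+-suc _ _) (cong suc (length-filter-split xs))

  AtMostOne : List A → Set
  AtMostOne xs = ∀ {c d} → c ∈ xs → d ∈ xs → P c → P d → c ≡ d

  length-filter-≤1 : ∀ {xs} → Unique xs → AtMostOne xs → length (filter P? xs) ≤ 1
  length-filter-≤1 [] _ = z≤n
  length-filter-≤1 {x ∷ xs} (x∉xs ∷ xs!) one with P? x
  ... | yes px = s≤s (≤-reflexive (cong length (filter-none P? (All.tabulate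
                   λ y∈ py → All.lookup x∉xs y∈ (one (here refl) (there y∈) px py)))))
  ... | no _ = length-filter-≤1 xs! (λ c∈ d∈ → one (there c∈) (there d∈))

  length-≤-suc-filter-∁ : ∀ {xs} → Unique xs → AtMostOne xs →
                          length xs ≤ suc (length (filter (¬? ∘ P?) xs))
  length-≤-suc-filter-∁ {xs} xs! one = subst (_≤ suc (length (filter (¬? ∘ P?) xs)))
    (length-filter-split xs) (+-monoˡ-≤ _ (length-filter-≤1 xs! one))

module _ {A : Set} (_≟_ : DecidableEquality A) where

  unique-⊆-length : ∀ {xs ys : List A} → Unique xs → (∀ {x} → x ∈ xs → x ∈ ys) →
                    length xs ≤ length ys
  unique-⊆-length {[]} _ _ = z≤n
  unique-⊆-length {x ∷ xs} {[]} _ xs⊆ with xs⊆ (here refl)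
  ... | ()
  unique-⊆-length {xs} {y ∷ ys} xs! xs⊆ =
    ≤-trans (length-≤-suc-filter-∁ (_≟ y) xs! (λ _ _ c≡y d≡y → trans c≡y (sym d≡y)))
            (s≤s (unique-⊆-length (filter⁺ (¬? ∘ (_≟ y)) xs!) rest⊆ys))
    where
    rest⊆ys : ∀ {x} → x ∈ filter (¬? ∘ (_≟ y)) xs → x ∈ ys
    rest⊆ys x∈ with ∈-filter⁻ (¬? ∘ (_≟ y)) x∈
    ... | x∈xs , x≢y with xs⊆ x∈xs
    ...   | here x≡y = ⊥-elim (x≢y x≡y)
    ...   | there x∈ys = x∈ys

  unique-image-< : ∀ {B : Set} → DecidableEquality B → (f : B → A) → ∀ {ts : List A} {ys : List B} {r} →
                   Unique ts → r ∈ ys → (∀ {t} → t ∈ ts → ∃ λ y → y ∈ ys × y ≢ r × f y ≡ t) →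
                   length ts < length ys
  unique-image-< _≟ᴮ_ f {ts} {ys} {r} ts! r∈ys covered =
    <-≤-trans (s≤s (≤-trans (unique-⊆-length ts! ts⊆) (≤-reflexive (length-map f others))))
              (filter-notAll (¬? ∘ (_≟ᴮ r)) ys (Any.map (λ y≡r y≢r → y≢r (sym y≡r)) r∈ys))
    where
    others = filter (¬? ∘ (_≟ᴮ r)) ys
    ts⊆ : ∀ {t} → t ∈ ts → t ∈ map f others
    ts⊆ t∈ with covered t∈
    ... | y , y∈ys , y≢r , refl = ∈-map⁺ f (∈-filter⁺ (¬? ∘ (_≟ᴮ r)) y∈ys y≢r)

≤1-∈-≡ : ∀ {A : Set} {xs : List A} {x y} → length xs ≤ 1 → x ∈ xs → y ∈ xs → x ≡ y
≤1-∈-≡ {xs = _ ∷ []} _ (here x≡z) (here y≡z) = trans x≡z (sym y≡z)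
≤1-∈-≡ {xs = _ ∷ _ ∷ _} (s≤s ()) _ _

Reach-mono : ∀ {n} {H K : Adj n} → (∀ {y z} → T (H y z) → T (K y z)) →
             ∀ {u z} → Reach H u z → Reach K u z
Reach-mono H⇒K here = here
Reach-mono H⇒K (step r e) = step (Reach-mono H⇒K r) (H⇒K e)

Reach-crossing : ∀ {n} {H : Adj n} (S : Fin n → Bool) {p z} → Reach H p z → ¬ T (S p) → T (S z) →
                 ∃ λ c → ∃ λ d → ¬ T (S c) × T (S d) × T (H c d)
Reach-crossing S here p∉S z∈S = ⊥-elim (p∉S z∈S)
Reach-crossing S (step {y} r e) p∉S z∈S with T? (S y)
... | yes y∈S = Reach-crossing S r p∉S y∈S
... | no y∉S = y , _ , y∉S , z∈S , e

-- Kempe swaps inside an induced subgraph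

module KempeOn {n : ℕ} (G : Adj n) (simple : IsSimple G)
               (M : ListAssignment n) (M! : ∀ x → Unique (M x)) where

  G-sym : ∀ {x y} → T (G x y) → T (G y x)
  G-sym {x} {y} = subst T (proj₁ simple x y)

  G-irrefl : ∀ {x y} → T (G x y) → x ≢ y
  G-irrefl {x} g refl = subst T (proj₂ simple x) g

  VertexSet : Set
  VertexSet = Fin n → Bool

  size : VertexSet → ℕ
  size S = length (filter (T? ∘ S) (allFin n))

  _∖_ : VertexSet → Fin n → VertexSet
  (S ∖ x) z = S z ∧ not ⌊ z ≟F x ⌋

  ∈-∖⁻ : ∀ S {x z} → T ((S ∖ x) z) → T (S z) × z ≢ x
  ∈-∖⁻ S {z = z} t = Product.map₂ toWitnessFalse (T-∧⁻ (S z) t)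

  ∈-∖⁺ : ∀ S {x z} → T (S z) → z ≢ x → T ((S ∖ x) z)
  ∈-∖⁺ S z∈S z≢x = T-∧⁺ z∈S (fromWitnessFalse z≢x)

  record ProperOn (S : VertexSet) (φ : Colouring n) : Set where
    field
      proper : ∀ x y → T (S x) → T (S y) → T (G x y) → φ x ≢ φ y
      fromList : ∀ x → T (S x) → φ x ∈ M x
  open ProperOn public

  ProperOn-∖ : ∀ {S x φ} → ProperOn S φ → ProperOn (S ∖ x) φ
  ProperOn-∖ {S} φp = record
    { proper = λ y z y∈ z∈ → proper φp y z (proj₁ (∈-∖⁻ S y∈)) (proj₁ (∈-∖⁻ S z∈))
    ; fromList = λ z z∈ → fromList φp z (proj₁ (∈-∖⁻ S z∈)) }

  AgreeOn : VertexSet → Colouring n → Colouring n → Set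
  AgreeOn S θ φ = ∀ z → T (S z) → θ z ≡ φ z

  KempeSubOn : VertexSet → Colouring n → Colour → Colour → Adj n
  KempeSubOn S φ α β x y = S x ∧ (S y ∧ KempeSub G φ α β x y)

  KempeEdgeOn : VertexSet → Colouring n → Colour → Colour → Fin n → Fin n → Set
  KempeEdgeOn S φ α β x y = T (S x) × T (S y) × T (G x y) × φ x ∈₂ α , β × φ y ∈₂ α , β

  kempeEdge⁻ : ∀ {S φ α β} x y → T (KempeSubOn S φ α β x y) → KempeEdgeOn S φ α β x y
  kempeEdge⁻ {S} {φ} {α} {β} x y t with T-∧⁻ (S x) t
  ... | x∈ , t with T-∧⁻ (S y) t
  ...   | y∈ , t with T-∧⁻ (G x y) t
  ...     | g , t with T-∧⁻ (⌊ φ x ≟ℕ α ⌋ ∨ ⌊ φ x ≟ℕ β ⌋) t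
  ...       | cx , cy = x∈ , y∈ , g , ∈₂-reflects cx , ∈₂-reflects cy

  kempeEdge⁺ : ∀ {S φ α β x y} → KempeEdgeOn S φ α β x y → T (KempeSubOn S φ α β x y)
  kempeEdge⁺ (x∈ , y∈ , g , cx , cy) =
    T-∧⁺ x∈ (T-∧⁺ y∈ (T-∧⁺ g (T-∧⁺ (∈₂-reflected cx) (∈₂-reflected cy))))

  Chain : VertexSet → Colouring n → Colour → Colour → Fin n → Fin n → Set
  Chain S φ α β = Reach (KempeSubOn S φ α β)

  chain-∈ : ∀ {S φ α β u z} → Chain S φ α β u z → T (S u) → T (S z)
  chain-∈ here u∈ = u∈
  chain-∈ {S} {φ} {α} {β} (step {y} {z} _ e) _ = proj₁ (proj₂ (kempeEdge⁻ {S} {φ} {α} {β} y z e))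

  chain-∈₂ : ∀ {S φ α β u z} → Chain S φ α β u z → φ u ∈₂ α , β → φ z ∈₂ α , β
  chain-∈₂ here cu = cu
  chain-∈₂ {S} {φ} {α} {β} (step {y} {z} _ e) _ =
    proj₂ (proj₂ (proj₂ (proj₂ (kempeEdge⁻ {S} {φ} {α} {β} y z e))))

  chain-mono : ∀ {S S′ θ φ α β} → (∀ z → T (S′ z) → T (S z)) → AgreeOn S′ θ φ →
               ∀ {u z} → Chain S′ φ α β u z → Chain S θ α β u z
  chain-mono {S} {S′} {θ} {φ} {α} {β} S′⊆S agree = Reach-mono λ {y} {z} e →
    let (y∈ , z∈ , g , cy , cz) = kempeEdge⁻ {S′} {φ} {α} {β} y z e
    in kempeEdge⁺ (S′⊆S y y∈ , S′⊆S z z∈ , g ,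
                   subst (_∈₂ α , β) (sym (agree y y∈)) cy , subst (_∈₂ α , β) (sym (agree z z∈)) cz)

  SwapsAt : VertexSet → Colouring n → Fin n → Colour → Colour → Colouring n → Set
  SwapsAt S φ u α β ψ = ∀ z → T (S z) → (Chain S φ α β u z → ψ z ≡ swapCol α β (φ z))
                                       × (¬ Chain S φ α β u z → ψ z ≡ φ z)

  record SwapOn (S : VertexSet) (φ ψ : Colouring n) : Set where
    constructor swapOn
    field
      source : ProperOn S φ
      target : ProperOn S ψ
      pivot : Fin n
      α β : Colour
      pivot∈S : T (S pivot)
      pivot∈₂ : φ pivot ∈₂ α , β
      swaps : SwapsAt S φ pivot α β ψ

  Shares : Fin n → Fin n → Set
  Shares x y = Any (_∈ M y) (M x)

  RelevantNbr : VertexSet → Fin n → Fin n → Set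
  RelevantNbr S x y = T (S y) × T (G x y) × Shares x y

  relevantNbr? : ∀ S x → Decidable (RelevantNbr S x)
  relevantNbr? S x y = T? (S y) ×-dec T? (G x y) ×-dec any? (_∈? M y) (M x)

  relevantNbrs : VertexSet → Fin n → List (Fin n)
  relevantNbrs S x = filter (relevantNbr? S x) (allFin n)

  relevantNbrs-∈ : ∀ {S x y c} → T (S y) → T (G x y) → c ∈ M x → c ∈ M y → y ∈ relevantNbrs S x
  relevantNbrs-∈ {S} {x} {y} y∈ g cx cy =
    ∈-filter⁺ (relevantNbr? S x) (∈-allFin y)
              (y∈ , g , Any.map (λ { refl → cy }) cx)

  Degenerate : Set
  Degenerate = ∀ S → (∃ λ z → T (S z)) →
               ∃ λ x → T (S x) × length (relevantNbrs S x) < length (M x)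

  -- Every swap of S ∖ x lifts to at most two swaps of S: possibly a recolouring of x, then the
  -- same chain, which either avoids x or absorbs it.
  module Lift (S : VertexSet) (x : Fin n) (x∈S : T (S x))
              (sparse : length (relevantNbrs S x) < length (M x)) where

    S⁻ : VertexSet
    S⁻ = S ∖ x

    S⁻⊆S : ∀ z → T (S⁻ z) → T (S z)
    S⁻⊆S z z∈ = proj₁ (∈-∖⁻ S z∈)

    x∉S⁻ : ¬ T (S⁻ x)
    x∉S⁻ x∈ = proj₂ (∈-∖⁻ S x∈) refl

    ∈S⁻ : ∀ {z} → T (S z) → z ≢ x → T (S⁻ z)
    ∈S⁻ = ∈-∖⁺ S

    nbr∈S⁻ : ∀ {y} → T (S y) → T (G x y) → T (S⁻ y)
    nbr∈S⁻ y∈ g = ∈S⁻ y∈ (λ y≡x → G-irrefl g (sym y≡x))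

    size-S⁻ : size S⁻ < size S
    size-S⁻ = length-filter-mono-< (T? ∘ S⁻) (T? ∘ S) (S⁻⊆S _) (∈-allFin x) x∈S x∉S⁻

    opaque
      recolour : Colour → Colouring n → Colouring n
      recolour c φ z = if ⌊ z ≟F x ⌋ then c else φ z

      recolour-x : ∀ {c φ} → recolour c φ x ≡ c
      recolour-x with x ≟F x
      ... | yes _ = refl
      ... | no x≢x = ⊥-elim (x≢x refl)

      recolour-≢ : ∀ {c φ z} → z ≢ x → recolour c φ z ≡ φ z
      recolour-≢ {z = z} z≢x with z ≟F x
      ... | yes z≡x = ⊥-elim (z≢x z≡x)
      ... | no _ = refl

    recolour-agree : ∀ {c φ} → AgreeOn S⁻ (recolour c φ) φ
    recolour-agree z z∈ = recolour-≢ (proj₂ (∈-∖⁻ S z∈))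

    Fresh : Colour → Colouring n → Set
    Fresh c φ = ∀ z → T (S⁻ z) → T (G x z) → c ≢ φ z

    recolour-proper : ∀ {c φ} → ProperOn S⁻ φ → c ∈ M x → Fresh c φ → ProperOn S (recolour c φ)
    recolour-proper {c} {φ} φp c∈ fresh = record { proper = proper′ ; fromList = fromList′ }
      where
      proper′ : ∀ y z → T (S y) → T (S z) → T (G y z) → recolour c φ y ≢ recolour c φ z
      proper′ y z y∈ z∈ g with y ≟F x | z ≟F x
      ... | yes refl | yes refl = λ _ → G-irrefl g refl
      ... | yes refl | no z≢x = λ e →
        fresh z (∈S⁻ z∈ z≢x) g (trans (sym recolour-x) (trans e (recolour-≢ z≢x)))
      ... | no y≢x | yes refl = λ e →
        fresh y (∈S⁻ y∈ y≢x) (G-sym g) (trans (sym recolour-x) (trans (sym e) (recolour-≢ y≢x)))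
      ... | no y≢x | no z≢x = λ e →
        proper φp y z (∈S⁻ y∈ y≢x) (∈S⁻ z∈ z≢x) g (trans (sym (recolour-≢ y≢x)) (trans e (recolour-≢ z≢x)))
      fromList′ : ∀ z → T (S z) → recolour c φ z ∈ M z
      fromList′ z z∈ with z ≟F x
      ... | yes refl = subst (_∈ M x) (sym recolour-x) c∈
      ... | no z≢x = subst (_∈ M z) (sym (recolour-≢ z≢x)) (fromList φp z (∈S⁻ z∈ z≢x))

    -- With α = θ x and β = ψ x the Kempe chain of x is {x} alone.
    recolourSwap : ∀ {θ ψ} → ProperOn S θ → ProperOn S ψ → AgreeOn S⁻ ψ θ →
                   (∀ y → T (S y) → T (G x y) → θ y ≢ ψ x) → SwapOn S θ ψ
    recolourSwap {θ} {ψ} θp ψp agree nbrs = swapOn θp ψp x (θ x) (ψ x) x∈S (inj₁ refl) swaps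
      where
      isolated : ∀ {z} → Chain S θ (θ x) (ψ x) x z → z ≡ x
      isolated here = refl
      isolated (step {y} {z} r e) with isolated r
      ... | refl with kempeEdge⁻ {S} {θ} {θ x} {ψ x} x z e
      ...   | _ , z∈ , g , _ , inj₁ θz≡θx = ⊥-elim (proper θp x z x∈S z∈ g (sym θz≡θx))
      ...   | _ , z∈ , g , _ , inj₂ θz≡ψx = ⊥-elim (nbrs z z∈ g θz≡ψx)
      swaps : SwapsAt S θ x (θ x) (ψ x) ψ
      swaps z z∈ = (λ r → at-x (isolated r))
                 , (λ ¬r → agree z (∈S⁻ z∈ λ z≡x → ¬r (subst (Chain S θ (θ x) (ψ x) x) (sym z≡x) here)))
        where
        at-x : z ≡ x → ψ z ≡ swapCol (θ x) (ψ x) (θ z)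
        at-x refl = sym (swapCol-α (θ x) (ψ x))

    crowded : ∀ (θ : Colouring n) {γ r} → γ ∈ M x → r ∈ relevantNbrs S x →
              let Mx∖γ = filter (¬? ∘ (_≟ℕ γ)) (M x) in
              (∀ {t} → t ∈ Mx∖γ → ∃ λ y → y ∈ relevantNbrs S x × y ≢ r × θ y ≡ t) → ⊥
    crowded θ {γ} γ∈ r∈ covered = n≮n (length (M x)) (begin-strict
      length (M x)
        ≤⟨ length-≤-suc-filter-∁ (_≟ℕ γ) (M! x) (λ _ _ c≡γ d≡γ → trans c≡γ (sym d≡γ)) ⟩
      suc (length (filter (¬? ∘ (_≟ℕ γ)) (M x)))
        ≤⟨ unique-image-< _≟ℕ_ _≟F_ θ (filter⁺ (¬? ∘ (_≟ℕ γ)) (M! x)) r∈ covered ⟩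
      length (relevantNbrs S x)
        <⟨ sparse ⟩
      length (M x) ∎)
      where open ≤-Reasoning

    Lifted : Colouring n → Colouring n → Set
    Lifted θ φ = ∃ λ θ′ → Star (SwapOn S) θ θ′ × ProperOn S θ′ × AgreeOn S⁻ θ′ φ

    Lifted-◅ : ∀ {θ θ′ φ} → SwapOn S θ θ′ → Lifted θ′ φ → Lifted θ φ
    Lifted-◅ s (θ″ , steps , θ″p , agree) = θ″ , s ◅ steps , θ″p , agree

    module LiftSwap {φ₁ φ₂ : Colouring n} (u : Fin n) (α β : Colour) (φ₂p : ProperOn S⁻ φ₂)
                (u∈ : T (S⁻ u)) (u∈₂ : φ₁ u ∈₂ α , β) (swaps : SwapsAt S⁻ φ₁ u α β φ₂) where

      InChain : Fin n → Set
      InChain = Chain S⁻ φ₁ α β u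

      inChain-∈ : ∀ {z} → InChain z → T (S⁻ z)
      inChain-∈ r = chain-∈ {S⁻} {φ₁} {α} {β} r u∈

      inChain-≢ : ∀ {z} → InChain z → z ≢ x
      inChain-≢ r = proj₂ (∈-∖⁻ S (inChain-∈ r))

      module Extending {θ : Colouring n} (θp : ProperOn S θ) (agree : AgreeOn S⁻ θ φ₁) where

        Reached : Fin n → Set
        Reached = Chain S θ α β u

        reached : ∀ {z} → InChain z → Reached z
        reached = chain-mono S⁻⊆S agree

        θu∈₂ : θ u ∈₂ α , β
        θu∈₂ = subst (_∈₂ α , β) (sym (agree u u∈)) u∈₂

        inChain-φ₂ : ∀ {z} → InChain z → φ₂ z ≡ swapCol α β (θ z)
        inChain-φ₂ {z} r =
          trans (proj₁ (swaps z (inChain-∈ r)) r) (cong (swapCol α β) (sym (agree z (inChain-∈ r))))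

        outChain-φ₂ : ∀ {z} → T (S⁻ z) → ¬ InChain z → φ₂ z ≡ θ z
        outChain-φ₂ {z} z∈ ¬r = trans (proj₂ (swaps z z∈) ¬r) (sym (agree z z∈))

        -- Chains are not decidable, but the colour equation they entail is.
        ¬¬inChain-φ₂ : ∀ {z} → T (S⁻ z) → ¬ ¬ InChain z → φ₂ z ≡ swapCol α β (θ z)
        ¬¬inChain-φ₂ {z} z∈ ¬¬r =
          decidable-stable (φ₂ z ≟ℕ swapCol α β (θ z)) (λ ≢ → ¬¬r (λ r → ≢ (inChain-φ₂ r)))

        kempeEdge-S⁻ : ∀ {y z} → KempeEdgeOn S θ α β y z → y ≢ x → z ≢ x → T (KempeSubOn S⁻ φ₁ α β y z)
        kempeEdge-S⁻ {y} {z} (y∈ , z∈ , g , cy , cz) y≢x z≢x =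
          kempeEdge⁺ (∈S⁻ y∈ y≢x , ∈S⁻ z∈ z≢x , g ,
                      subst (_∈₂ α , β) (agree y (∈S⁻ y∈ y≢x)) cy , subst (_∈₂ α , β) (agree z (∈S⁻ z∈ z≢x)) cz)

        reached-cases : (∀ {z} → KempeEdgeOn S θ α β x z → ¬ ¬ InChain z) →
                        ∀ {z} → Reached z → ¬ ¬ InChain z ⊎ z ≡ x
        reached-cases x-nbrs here = inj₁ (λ ¬r → ¬r here)
        reached-cases x-nbrs (step {y} {z} r e) with reached-cases x-nbrs r | kempeEdge⁻ {S} {θ} {α} {β} y z e
        ... | inj₂ refl | edge = inj₁ (x-nbrs edge)
        ... | inj₁ ¬¬ry | edge with z ≟F x
        ...   | yes z≡x = inj₂ z≡x
        ...   | no z≢x = inj₁ (λ ¬rz → ¬¬ry (λ ry → ¬rz (step ry (kempeEdge-S⁻ edge (inChain-≢ ry) z≢x))))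

        lifted : ∀ {c} → c ∈ M x → Fresh c φ₂ → (∀ {z} → z ≢ x → Reached z → ¬ ¬ InChain z) →
                 (Reached x → c ≡ swapCol α β (θ x)) → (¬ Reached x → c ≡ θ x) → Lifted θ φ₂
        lifted {c} c∈ fresh reached⁻ x-reached x-unreached =
          recolour c φ₂ , swapOn θp θ′p u α β (S⁻⊆S u u∈) θu∈₂ swaps′ ◅ ε , θ′p , recolour-agree
          where
          θ′p : ProperOn S (recolour c φ₂)
          θ′p = recolour-proper φ₂p c∈ fresh
          swaps′ : SwapsAt S θ u α β (recolour c φ₂)
          swaps′ z z∈ with z ≟F x
          ... | yes refl = (λ r → trans recolour-x (x-reached r)) , (λ ¬r → trans recolour-x (x-unreached ¬r))
          ... | no z≢x = (λ r → trans (recolour-≢ z≢x) (¬¬inChain-φ₂ (∈S⁻ z∈ z≢x) (reached⁻ z≢x r)))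
                       , (λ ¬r → trans (recolour-≢ z≢x) (outChain-φ₂ (∈S⁻ z∈ z≢x) (¬r ∘ reached)))

        Avoids : Set
        Avoids = ∀ y → InChain y → ¬ KempeEdgeOn S θ α β y x

        liftAvoiding : Avoids → Lifted θ φ₂
        liftAvoiding avoids = lifted (fromList θp x x∈S) fresh (λ _ r ¬r → ¬r (stays r))
                                     (λ r → ⊥-elim (inChain-≢ (stays r) refl)) (λ _ → refl)
          where
          stays : ∀ {z} → Reached z → InChain z
          stays here = here
          stays (step {y} {z} r e) with stays r | z ≟F x
          ... | ry | yes refl = ⊥-elim (avoids y ry (kempeEdge⁻ {S} {θ} {α} {β} y x e))
          ... | ry | no z≢x = step ry (kempeEdge-S⁻ (kempeEdge⁻ {S} {θ} {α} {β} y z e) (inChain-≢ ry) z≢x)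
          fresh : Fresh (θ x) φ₂
          fresh z z∈ g θx≡φ₂z = proper θp x z x∈S (S⁻⊆S z z∈) g (trans θx≡φ₂z (outChain-φ₂ z∈ outside))
            where
            outside : ¬ InChain z
            outside r = avoids z r (S⁻⊆S z z∈ , x∈S , G-sym g , cz ,
                                    subst (_∈₂ α , β) (sym (trans θx≡φ₂z (inChain-φ₂ r))) (swapCol-∈₂ cz))
              where cz = chain-∈₂ {S} {θ} (reached r) θu∈₂

        liftThrough : θ x ∈₂ α , β → ∀ {y₀} → T (S y₀) → T (G x y₀) →
                      θ y₀ ≡ swapCol α β (θ x) → φ₂ y₀ ≡ θ x → swapCol α β (θ x) ∈ M x →
                      (∀ y → T (S y) → T (G x y) → θ y ≡ swapCol α β (θ x) → y ≡ y₀) → Lifted θ φ₂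
        liftThrough γ∈ {y₀} y₀∈ g₀ θy₀ φ₂y₀ o∈ unique =
          lifted o∈ fresh reached⁻ (λ _ → refl) (λ ¬r → ⊥-elim (y₀-inChain (¬r ∘ x-reached)))
          where
          γ = θ x
          o = swapCol α β γ
          o≢γ : o ≢ γ
          o≢γ o≡γ = proper θp x y₀ x∈S y₀∈ g₀ (sym (trans θy₀ o≡γ))
          y₀-inChain : ¬ ¬ InChain y₀
          y₀-inChain ¬r = o≢γ (trans (sym θy₀) (trans (sym (outChain-φ₂ (nbr∈S⁻ y₀∈ g₀) ¬r)) φ₂y₀))
          x-reached : InChain y₀ → Reached x
          x-reached r = step (reached r) (kempeEdge⁺ (y₀∈ , x∈S , G-sym g₀ ,
                                                     subst (_∈₂ α , β) (sym θy₀) (swapCol-∈₂ γ∈) , γ∈))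
          x-nbrs : ∀ {z} → KempeEdgeOn S θ α β x z → ¬ ¬ InChain z
          x-nbrs (_ , z∈ , g , _ , cz) = subst (λ w → ¬ ¬ InChain w) (sym z≡y₀) y₀-inChain
            where
            z≡y₀ = unique _ z∈ g (swapCol-other cz γ∈ (proper θp x _ x∈S z∈ g ∘ sym))
          reached⁻ : ∀ {z} → z ≢ x → Reached z → ¬ ¬ InChain z
          reached⁻ z≢x r = [ id , ⊥-elim ∘ z≢x ] (reached-cases x-nbrs r)
          fresh : Fresh o φ₂
          fresh z z∈ g o≡φ₂z = outside inside
            where
            inside : ¬ InChain z
            inside r = proper θp x z x∈S (S⁻⊆S z z∈) g (sym (begin
              θ z                              ≡⟨ sym (swapCol-involutive (chain-∈₂ {S} {θ} (reached r) θu∈₂)) ⟩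
              swapCol α β (swapCol α β (θ z))  ≡⟨ cong (swapCol α β) (sym (inChain-φ₂ r)) ⟩
              swapCol α β (φ₂ z)               ≡⟨ cong (swapCol α β) (sym o≡φ₂z) ⟩
              swapCol α β o                    ≡⟨ swapCol-involutive γ∈ ⟩
              γ                                ∎))
              where open ≡-Reasoning
            outside : ¬ ¬ InChain z
            outside ¬r = o≢γ (trans o≡φ₂z (subst (λ w → φ₂ w ≡ γ) (sym z≡y₀) φ₂y₀))
              where
              z≡y₀ : z ≡ y₀
              z≡y₀ = unique z (S⁻⊆S z z∈) g (trans (sym (outChain-φ₂ z∈ ¬r)) (sym o≡φ₂z))

        module Crowded (γ∈ : θ x ∈₂ α , β)
                       (occupied : ∀ {t} → t ∈ M x → ¬ t ∈₂ α , β → ∃ λ y → T (S y) × T (G x y) × θ y ≡ t) where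

          o : Colour
          o = swapCol α β (θ x)

          γ∈M : θ x ∈ M x
          γ∈M = fromList θp x x∈S

          chainNbr-φ₂ : ∀ {y} → InChain y → θ y ≡ o → φ₂ y ≡ θ x
          chainNbr-φ₂ r θy = trans (inChain-φ₂ r) (trans (cong (swapCol α β) θy) (swapCol-involutive γ∈))

          avoidsUnless : (∀ {y} → InChain y → T (S y) → T (G x y) → θ y ≡ o → ⊥) → Avoids
          avoidsUnless no-o y r (y∈ , _ , g , cy , _) =
            no-o r y∈ (G-sym g) (swapCol-other cy γ∈ (proper θp y x y∈ x∈S g))

          covered : ∀ {r} → θ r ≡ o → (o ∈ M x → ∃ λ y₀ → y₀ ≢ r × T (S y₀) × T (G x y₀) × θ y₀ ≡ o) →
                    ∀ {t} → t ∈ filter (¬? ∘ (_≟ℕ θ x)) (M x) →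
                    ∃ λ y → y ∈ relevantNbrs S x × y ≢ r × θ y ≡ t
          covered {r} θr other {t} t∈ with ∈-filter⁻ (¬? ∘ (_≟ℕ θ x)) t∈ | t ≟ℕ o
          ... | t∈M , _ | yes refl with other t∈M
          ...   | y₀ , y₀≢r , y₀∈ , g₀ , θy₀ =
            y₀ , relevantNbrs-∈ y₀∈ g₀ t∈M (subst (_∈ M y₀) θy₀ (fromList θp y₀ y₀∈)) , y₀≢r , θy₀
          covered {r} θr other {t} t∈ | t∈M , t≢γ | no t≢o
            with occupied t∈M (λ t∈₂ → t≢o (swapCol-other t∈₂ γ∈ t≢γ))
          ... | y , y∈ , g , θy =
            y , relevantNbrs-∈ y∈ g t∈M (subst (_∈ M y) θy (fromList θp y y∈)) ,
            (λ { refl → t≢o (trans (sym θy) θr) }) , θy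

          onlyNbr-o : o ∈ M x → ∀ {y₀} → T (S y₀) → T (G x y₀) → θ y₀ ≡ o →
                      ∀ y → T (S y) → T (G x y) → θ y ≡ o → y ≡ y₀
          onlyNbr-o o∈ {y₀} y₀∈ g₀ θy₀ y y∈ g θy with y ≟F y₀
          ... | yes y≡y₀ = y≡y₀
          ... | no y≢y₀ = ⊥-elim (crowded θ γ∈M (relevantNbrs-∈ y∈ g o∈ (subst (_∈ M y) θy (fromList θp y y∈)))
                                         (covered θy (λ _ → y₀ , (λ e → y≢y₀ (sym e)) , y₀∈ , g₀ , θy₀)))

          liftCrowded : Lifted θ φ₂
          liftCrowded with FinP.any? (λ y → T? (S y) ×-dec T? (G x y) ×-dec (θ y ≟ℕ o))
          ... | no none = liftAvoiding (avoidsUnless λ _ y∈ g θy → none (_ , y∈ , g , θy))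
          ... | yes (y₀ , y₀∈ , g₀ , θy₀) with o ∈? M x
          ...   | no o∉ = liftAvoiding (avoidsUnless λ {y} r y∈ g θy →
                    crowded θ γ∈M (relevantNbrs-∈ y∈ g γ∈M
                                     (subst (_∈ M y) (chainNbr-φ₂ r θy) (fromList φ₂p y (inChain-∈ r))))
                            (covered θy (⊥-elim ∘ o∉)))
          ...   | yes o∈ with φ₂ y₀ ≟ℕ θ x
          ...     | yes φ₂y₀ = liftThrough γ∈ y₀∈ g₀ θy₀ φ₂y₀ o∈ (onlyNbr-o o∈ y₀∈ g₀ θy₀)
          ...     | no φ₂y₀≢ = liftAvoiding (avoidsUnless λ {y} r y∈ g θy →
                    φ₂y₀≢ (subst (λ w → φ₂ w ≡ θ x) (onlyNbr-o o∈ y₀∈ g₀ θy₀ y y∈ g θy) (chainNbr-φ₂ r θy)))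

      FreeColour : Colouring n → Colour → Set
      FreeColour θ δ = ¬ δ ∈₂ α , β × (∀ y → T (S y) → T (G x y) → θ y ≢ δ)

      avoided? : ∀ (θ : Colouring n) δ → Dec (∀ y → T (S y) → T (G x y) → θ y ≢ δ)
      avoided? θ δ = FinP.all? (λ y → T? (S y) →-dec T? (G x y) →-dec ¬? (θ y ≟ℕ δ))

      occupied : ∀ {θ} → ¬ Any (FreeColour θ) (M x) →
                 ∀ {t} → t ∈ M x → ¬ t ∈₂ α , β → ∃ λ y → T (S y) × T (G x y) × θ y ≡ t
      occupied {θ} noFree {t} t∈ t∉₂ with avoided? θ t
      ... | yes avoided = ⊥-elim (noFree (Any.map (λ { refl → t∉₂ , avoided }) t∈))
      ... | no ¬avoided with FinP.¬∀⟶∃¬ n _ (λ y → T? (S y) →-dec T? (G x y) →-dec ¬? (θ y ≟ℕ t)) ¬avoided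
      ...   | y , ¬avoids with T? (S y) | T? (G x y) | θ y ≟ℕ t
      ...     | yes y∈ | yes g | yes θy = y , y∈ , g , θy
      ...     | no y∉ | _ | _ = ⊥-elim (¬avoids (⊥-elim ∘ y∉))
      ...     | yes _ | no ¬g | _ = ⊥-elim (¬avoids (λ _ → ⊥-elim ∘ ¬g))
      ...     | yes _ | yes _ | no θy≢ = ⊥-elim (¬avoids (λ _ _ → θy≢))

      liftViaFree : ∀ {θ} → ProperOn S θ → AgreeOn S⁻ θ φ₁ →
                    ∃ (λ δ → δ ∈ M x × FreeColour θ δ) → Lifted θ φ₂
      liftViaFree {θ} θp agree (δ , δ∈ , δ∉₂ , free) =
        Lifted-◅ (recolourSwap θp θ′p recolour-agree (λ y y∈ g e → free y y∈ g (trans e recolour-x)))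
                 (Extending.liftAvoiding θ′p agree′ avoids)
        where
        θ′p : ProperOn S (recolour δ θ)
        θ′p = recolour-proper (ProperOn-∖ θp) δ∈ (λ z z∈ g e → free z (S⁻⊆S z z∈) g (sym e))
        agree′ : AgreeOn S⁻ (recolour δ θ) φ₁
        agree′ z z∈ = trans (recolour-agree z z∈) (agree z z∈)
        avoids : Extending.Avoids θ′p agree′
        avoids _ _ (_ , _ , _ , _ , cx) = δ∉₂ (subst (_∈₂ α , β) recolour-x cx)

      liftStep : ∀ {θ} → ProperOn S θ → AgreeOn S⁻ θ φ₁ → Lifted θ φ₂
      liftStep {θ} θp agree with ∈₂? (θ x) α β
      ... | no γ∉₂ = Extending.liftAvoiding θp agree (λ _ _ (_ , _ , _ , _ , γ∈₂) → γ∉₂ γ∈₂)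
      ... | yes γ∈₂ with any? (λ δ → ¬? (∈₂? δ α β) ×-dec avoided? θ δ) (M x)
      ...   | yes free = liftViaFree θp agree (find free)
      ...   | no noFree = Extending.Crowded.liftCrowded θp agree γ∈₂ (occupied noFree)

    liftStar : ∀ {φ₁ φ₂ θ} → Star (SwapOn S⁻) φ₁ φ₂ → ProperOn S θ → AgreeOn S⁻ θ φ₁ → Lifted θ φ₂
    liftStar ε θp agree = _ , ε , θp , agree
    liftStar {φ₁} (swapOn _ φ₂p u α β u∈ u∈₂ swaps ◅ rest) θp agree
      with LiftSwap.liftStep {φ₁} u α β φ₂p u∈ u∈₂ swaps θp agree
    ... | θ′ , steps , θ′p , agree′ with liftStar rest θ′p agree′
    ...   | θ″ , steps′ , θ″p , agree″ = θ″ , steps ◅◅ steps′ , θ″p , agree″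

    extend : ∀ {φ θ ψ} → ProperOn S ψ → Star (SwapOn S) φ θ → ProperOn S θ → AgreeOn S⁻ θ ψ →
             Star (SwapOn S) φ ψ
    extend {ψ = ψ} ψp steps θp agree = steps ◅◅ (recolourSwap θp ψp (λ z z∈ → sym (agree z z∈)) nbrs ◅ ε)
      where
      nbrs : ∀ y → T (S y) → T (G x y) → _ ≢ ψ x
      nbrs y y∈ g e = proper ψp y x y∈ x∈S (G-sym g) (trans (sym (agree y (nbr∈S⁻ y∈ g))) e)

  module _ (degenerate : Degenerate) where

    connectedWithin : ∀ k S → size S ≤ k → ∀ {φ ψ} → ProperOn S φ → ProperOn S ψ →
                      ∃ λ χ → Star (SwapOn S) φ χ × AgreeOn S χ ψ
    connectedWithin k S bound {φ} φp ψp with FinP.any? (T? ∘ S)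
    ... | no empty = φ , ε , λ z z∈ → ⊥-elim (empty (z , z∈))
    ... | yes nonempty with degenerate S nonempty | k
    ...   | x , x∈S , sparse | zero = ⊥-elim (n≮0 (≤-trans (Lift.size-S⁻ S x x∈S sparse) bound))
    ...   | x , x∈S , sparse | suc k
      with connectedWithin k (S ∖ x) (≤-pred (≤-trans (Lift.size-S⁻ S x x∈S sparse) bound))
                           (ProperOn-∖ φp) (ProperOn-∖ ψp)
    ...     | χ , steps , agree with Lift.liftStar S x x∈S sparse steps φp (λ _ _ → refl)
    ...       | θ , steps′ , θp , agree′ =
      _ , Lift.extend S x x∈S sparse ψp steps′ θp (λ z z∈ → trans (agree′ z z∈) (agree z z∈)) , λ _ _ → refl

    swapConnected : ∀ S {φ ψ} → ProperOn S φ → ProperOn S ψ → ∃ λ χ → Star (SwapOn S) φ χ × AgreeOn S χ ψ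
    swapConnected S = connectedWithin _ S ≤-refl

-- Pruning the lists at the ends of the deleted edge

_∖ᴸ_ : List Colour → List Colour → List Colour
A ∖ᴸ B = filter (¬? ∘ (_∈? B)) A

∣∩∣≤1⇒AtMostOne : ∀ {A B} → ∣ A ∩ B ∣ ≤ 1 → AtMostOne (_∈? B) A
∣∩∣≤1⇒AtMostOne {A} {B} ∣A∩B∣≤1 c∈A d∈A c∈B d∈B =
  ≤1-∈-≡ ∣A∩B∣≤1 (∈-filter⁺ (_∈? B) c∈A c∈B) (∈-filter⁺ (_∈? B) d∈A d∈B)

AtMostOne-swap : ∀ {A B} → AtMostOne (_∈? B) A → AtMostOne (_∈? A) B
AtMostOne-swap one c∈B d∈B c∈A d∈A = one c∈A d∈A c∈B d∈B

module _ {n : ℕ} (L : ListAssignment n) (a : Fin n) (B : List Colour) where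

  opaque
    pruneAt : ListAssignment n
    pruneAt x = if ⌊ x ≟F a ⌋ then L x ∖ᴸ B else L x

    ∈-pruneAt⁻ : ∀ {x c} → c ∈ pruneAt x → c ∈ L x × (x ≡ a → c ∉ B)
    ∈-pruneAt⁻ {x} c∈ with x ≟F a
    ... | yes _ = Product.map₂ (λ c∉B _ → c∉B) (∈-filter⁻ (¬? ∘ (_∈? B)) c∈)
    ... | no x≢a = c∈ , ⊥-elim ∘ x≢a

    ∈-pruneAt⁺ : ∀ {x c} → c ∈ L x → (x ≡ a → c ∉ B) → c ∈ pruneAt x
    ∈-pruneAt⁺ {x} c∈ c∉ with x ≟F a
    ... | yes x≡a = ∈-filter⁺ (¬? ∘ (_∈? B)) c∈ (c∉ x≡a)
    ... | no _ = c∈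

    pruneAt-≡ : pruneAt a ≡ L a ∖ᴸ B
    pruneAt-≡ with a ≟F a
    ... | yes _ = refl
    ... | no a≢a = ⊥-elim (a≢a refl)

    pruneAt-≢ : ∀ {x} → x ≢ a → pruneAt x ≡ L x
    pruneAt-≢ {x} x≢a with x ≟F a
    ... | yes x≡a = ⊥-elim (x≢a x≡a)
    ... | no _ = refl

    pruneAt-unique : (∀ x → Unique (L x)) → ∀ x → Unique (pruneAt x)
    pruneAt-unique L! x with x ≟F a
    ... | yes _ = filter⁺ (¬? ∘ (_∈? B)) (L! x)
    ... | no _ = L! x

module DeleteEdge {n : ℕ} (G : Adj n) (simple : IsSimple G) (v w : Fin n) where

  H : Adj n
  H = deleteEdge G v w

  H⊆G : ∀ {x y} → T (H x y) → T (G x y)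
  H⊆G {x} {y} h = proj₁ (T-∧⁻ (G x y) h)

  H-sym : ∀ {x y} → T (H x y) → T (H y x)
  H-sym {x} {y} = subst T (cong₂ _∧_ (proj₁ simple x y) (cong not (begin
    (⌊ x ≟F v ⌋ ∧ ⌊ y ≟F w ⌋) ∨ (⌊ x ≟F w ⌋ ∧ ⌊ y ≟F v ⌋)
      ≡⟨ ∨-comm (⌊ x ≟F v ⌋ ∧ ⌊ y ≟F w ⌋) _ ⟩
    (⌊ x ≟F w ⌋ ∧ ⌊ y ≟F v ⌋) ∨ (⌊ x ≟F v ⌋ ∧ ⌊ y ≟F w ⌋)
      ≡⟨ cong₂ _∨_ (∧-comm ⌊ x ≟F w ⌋ _) (∧-comm ⌊ x ≟F v ⌋ _) ⟩
    (⌊ y ≟F v ⌋ ∧ ⌊ x ≟F w ⌋) ∨ (⌊ y ≟F w ⌋ ∧ ⌊ x ≟F v ⌋) ∎)))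
    where open ≡-Reasoning

  H-missing : ∀ {x y} → T (G x y) → ¬ T (H x y) → (x ≡ v × y ≡ w) ⊎ (x ≡ w × y ≡ v)
  H-missing {x} {y} g ¬h with x ≟F v | y ≟F w | x ≟F w | y ≟F v
  ... | yes x≡v | yes y≡w | _ | _ = inj₁ (x≡v , y≡w)
  ... | _ | _ | yes x≡w | yes y≡v = inj₂ (x≡w , y≡v)
  ... | no _ | _ | no _ | _ = ⊥-elim (¬h (T-∧⁺ g _))
  ... | no _ | _ | yes _ | no _ = ⊥-elim (¬h (T-∧⁺ g _))
  ... | yes _ | no _ | no _ | _ = ⊥-elim (¬h (T-∧⁺ g _))
  ... | yes _ | no _ | yes _ | no _ = ⊥-elim (¬h (T-∧⁺ g _))

  ¬Hvw : ¬ T (H v w)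
  ¬Hvw h with v ≟F v | w ≟F w
  ... | yes _ | yes _ = proj₂ (T-∧⁻ (G v w) h)
  ... | no v≢v | _ = v≢v refl
  ... | _ | no w≢w = w≢w refl

-- A Kempe swap with α = β changes nothing; it turns pointwise agreement into a step.
agreeingSwap : ∀ {n} {G : Adj n} {L χ ψ} (u : Fin n) → IsLColouring G L ψ → (∀ x → χ x ≡ ψ x) →
               LValidSwap G L χ ψ
agreeingSwap {χ = χ} u (ψ-proper , ψ∈L) agree =
  ((λ x y g e → ψ-proper x y g (trans (sym (agree x)) (trans e (agree y))))
   , λ x → subst (_∈ _) (sym (agree x)) (ψ∈L x)) ,
  (ψ-proper , ψ∈L) , u , χ u , χ u , inj₁ refl ,
  λ x → (λ _ → trans (sym (agree x)) (sym (swapCol-same (χ u) (χ x)))) , (λ _ → sym (agree x))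

module Pruned {n : ℕ} (G : Adj n) (simple : IsSimple G) (L : ListAssignment n) (deg : IsDegreeAssignment G L)
              (H : Adj n) (H⊆G : ∀ {x y} → T (H x y) → T (G x y)) (H-sym : ∀ {x y} → T (H x y) → T (H y x))
              (connected : Connected H) (a b : Fin n) (gab : T (G a b)) (¬Hab : ¬ T (H a b))
              (H-missing : ∀ {x y} → T (G x y) → ¬ T (H x y) → (x ≡ a × y ≡ b) ⊎ (x ≡ b × y ≡ a))
              (common : AtMostOne (_∈? L b) (L a)) where

  -- The lists of a and b are disjoint in M, so ab never joins relevant neighbours.
  M : ListAssignment n
  M = pruneAt L a (L b)

  open KempeOn G simple M (pruneAt-unique L a (L b) (proj₁ ∘ deg))

  b≢a : b ≢ a
  b≢a b≡a = G-irrefl gab (sym b≡a)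

  degree-H≤G : ∀ x → degree H x ≤ degree G x
  degree-H≤G x = length-filter-mono (T? ∘ H x) (T? ∘ G x) H⊆G (allFin n)

  degree-H<G : ∀ {x y} → T (G x y) → ¬ T (H x y) → degree H x < degree G x
  degree-H<G {x} {y} g ¬h = length-filter-mono-< (T? ∘ H x) (T? ∘ G x) H⊆G (∈-allFin y) g ¬h

  degree-H≤pruned : degree H a ≤ length (L a ∖ᴸ L b)
  degree-H≤pruned = ≤-pred (begin-strict
    degree H a                   <⟨ degree-H<G gab ¬Hab ⟩
    degree G a                   ≡⟨ sym (proj₂ (deg a)) ⟩
    length (L a)                 ≤⟨ length-≤-suc-filter-∁ (_∈? L b) (proj₁ (deg a)) common ⟩
    suc (length (L a ∖ᴸ L b))    ∎)
    where open ≤-Reasoning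

  degree-H≤M : ∀ x → degree H x ≤ length (M x)
  degree-H≤M x with x ≟F a
  ... | yes refl = subst (λ l → degree H a ≤ length l) (sym (pruneAt-≡ L a (L b))) degree-H≤pruned
  ... | no x≢a = subst (λ l → degree H x ≤ length l) (sym (pruneAt-≢ L a (L b) x≢a))
                       (subst (degree H x ≤_) (sym (proj₂ (deg x))) (degree-H≤G x))

  degree-H<M-b : degree H b < length (M b)
  degree-H<M-b = subst (λ l → degree H b < length l) (sym (pruneAt-≢ L a (L b) b≢a))
                       (subst (degree H b <_) (sym (proj₂ (deg b))) (degree-H<G (G-sym gab) (¬Hab ∘ H-sym)))

  M-disjoint : ∀ {c} → c ∈ M a → c ∈ M b → ⊥
  M-disjoint c∈Ma c∈Mb = proj₂ (∈-pruneAt⁻ L a (L b) c∈Ma) refl (proj₁ (∈-pruneAt⁻ L a (L b) c∈Mb))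

  relevant⇒H : ∀ {S x y} → RelevantNbr S x y → T (H x y)
  relevant⇒H {S} {x} {y} (_ , g , shares) with T? (H x y)
  ... | yes h = h
  ... | no ¬h with find shares | H-missing g ¬h
  ...   | c , cx , cy | inj₁ (refl , refl) = ⊥-elim (M-disjoint cx cy)
  ...   | c , cx , cy | inj₂ (refl , refl) = ⊥-elim (M-disjoint cy cx)

  relevantNbrs≤degree : ∀ S x → length (relevantNbrs S x) ≤ degree H x
  relevantNbrs≤degree S x = length-filter-mono (relevantNbr? S x) (T? ∘ H x) (relevant⇒H {S}) (allFin n)

  relevantNbrs<degree : ∀ {S c d} → ¬ T (S c) → T (H d c) → length (relevantNbrs S d) < degree H d
  relevantNbrs<degree {S} {c} {d} c∉S h =
    length-filter-mono-< (relevantNbr? S d) (T? ∘ H d) (relevant⇒H {S}) (∈-allFin c) h (c∉S ∘ proj₁)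

  -- If S is everything, b is sparse as it lost the edge ab; otherwise some vertex of S has an
  -- H-neighbour outside S.
  degenerate : Degenerate
  degenerate S (z , z∈S) with FinP.all? (T? ∘ S)
  ... | yes everywhere = b , everywhere b , ≤-<-trans (relevantNbrs≤degree S b) degree-H<M-b
  ... | no ¬everywhere with FinP.¬∀⟶∃¬ n _ (T? ∘ S) ¬everywhere
  ...   | p , p∉S with Reach-crossing S (connected p z) p∉S z∈S
  ...     | c , d , c∉S , d∈S , hcd = d , d∈S , <-≤-trans (relevantNbrs<degree c∉S (H-sym hcd)) (degree-H≤M d)

  everywhere : VertexSet
  everywhere _ = true

  properEverywhere : ∀ {φ} → IsLColouring G L φ → φ a ∉ L b → ProperOn everywhere φ
  properEverywhere (φ-proper , φ∈L) φa∉ = record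
    { proper = λ x y _ _ → φ-proper x y
    ; fromList = λ x _ → ∈-pruneAt⁺ L a (L b) (φ∈L x) (λ { refl → φa∉ }) }

  isLColouring : ∀ {φ} → ProperOn everywhere φ → IsLColouring G L φ
  isLColouring φp = (λ x y → proper φp x y _ _) , (λ x → proj₁ (∈-pruneAt⁻ L a (L b) (fromList φp x _)))

  validSwap : ∀ {φ ψ} → SwapOn everywhere φ ψ → LValidSwap G L φ ψ
  validSwap (swapOn φp ψp u α β _ u∈₂ swaps) =
    isLColouring φp , isLColouring ψp , u , α , β , u∈₂ , (λ z → swaps z _)

  equivalent : ∀ {φ ψ} → IsLColouring G L φ → IsLColouring G L ψ → φ a ∉ L b → ψ a ∉ L b →
               LEquivalent G L φ ψ
  equivalent φc ψc φa∉ ψa∉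
    with swapConnected degenerate everywhere (properEverywhere φc φa∉) (properEverywhere ψc ψa∉)
  ... | χ , steps , agree = Star.map validSwap steps ◅◅ (agreeingSwap a ψc (λ x → agree x _) ◅ ε)

module ChoosableDeletion {n : ℕ} (G : Adj n) (simple : IsSimple G)
                         (L : ListAssignment n) (deg : IsDegreeAssignment G L) (v w : Fin n) (gvw : T (G v w))
                         (connected : Connected (deleteEdge G v w)) (choosable : DegreeChoosable (deleteEdge G v w))
                         (common : ∣ L v ∩ L w ∣ ≤ 1) where

  open DeleteEdge G simple v w

  commonᵛ : AtMostOne (_∈? L w) (L v)
  commonᵛ = ∣∩∣≤1⇒AtMostOne common

  module Pᵛ = Pruned G simple L deg H H⊆G H-sym connected v w gvw ¬Hvw H-missing commonᵛ
  module Pʷ = Pruned G simple L deg H H⊆G H-sym connected w v (subst T (proj₁ simple v w) gvw)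
                     (¬Hvw ∘ H-sym) (λ g ¬h → Sum.swap (H-missing g ¬h)) (AtMostOne-swap commonᵛ)

  -- θ is chosen in G - vw from lists pruned at both ends, so it is of both kinds.
  L₀ : ListAssignment n
  L₀ = pruneAt (pruneAt L v (L w)) w (L v)

  L₀-w : L₀ w ≡ L w ∖ᴸ L v
  L₀-w = trans (pruneAt-≡ (pruneAt L v (L w)) w (L v)) (cong (_∖ᴸ L v) (pruneAt-≢ L v (L w) Pᵛ.b≢a))

  degree-H≤L₀ : ∀ x → degree H x ≤ length (L₀ x)
  degree-H≤L₀ x = byCase (x ≟F w)
    where
    byCase : Dec (x ≡ w) → degree H x ≤ length (L₀ x)
    byCase (yes refl) = subst (λ l → degree H w ≤ length l) (sym L₀-w) Pʷ.degree-H≤pruned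
    byCase (no x≢w) = subst (λ l → degree H x ≤ length l)
                            (sym (pruneAt-≢ (pruneAt L v (L w)) w (L v) x≢w)) (Pᵛ.degree-H≤M x)

  L₀! : ∀ x → Unique (L₀ x)
  L₀! = pruneAt-unique _ w (L v) (pruneAt-unique L v (L w) (proj₁ ∘ deg))

  ∈L₀ : ∀ {x c} → c ∈ L₀ x → c ∈ L x × (x ≡ v → c ∉ L w) × (x ≡ w → c ∉ L v)
  ∈L₀ c∈ with ∈-pruneAt⁻ (pruneAt L v (L w)) w (L v) c∈
  ... | c∈′ , c∉Lv with ∈-pruneAt⁻ L v (L w) c∈′
  ...   | c∈L , c∉Lw = c∈L , c∉Lw , c∉Lv

  choice : ∃ λ θ → IsLColouring H (λ x → take (degree H x) (L₀ x)) θ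
  choice = choosable (λ x → take (degree H x) (L₀ x))
                      (λ x → take⁺ (degree H x) (L₀! x) ,
                             trans (length-take (degree H x) (L₀ x)) (m≤n⇒m⊓n≡m (degree-H≤L₀ x)))

  θ : Colouring n
  θ = proj₁ choice

  θ∈L₀ : ∀ x → θ x ∈ L₀ x
  θ∈L₀ x = lookup (take-⊆ (degree H x) (L₀ x)) (proj₂ (proj₂ choice) x)

  θv∉Lw : θ v ∉ L w
  θv∉Lw = proj₁ (proj₂ (∈L₀ (θ∈L₀ v))) refl

  θw∉Lv : θ w ∉ L v
  θw∉Lv = proj₂ (proj₂ (∈L₀ (θ∈L₀ w))) refl

  θ-colouring : IsLColouring G L θ
  θ-colouring = θ-proper , λ x → proj₁ (∈L₀ (θ∈L₀ x))
    where
    θ-proper : ∀ x y → T (G x y) → θ x ≢ θ y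
    θ-proper x y g with T? (H x y)
    ... | yes h = proj₁ (proj₂ choice) x y h
    ... | no ¬h with H-missing g ¬h
    ...   | inj₁ (refl , refl) = λ e → θv∉Lw (subst (_∈ L w) (sym e) (proj₁ (∈L₀ (θ∈L₀ w))))
    ...   | inj₂ (refl , refl) = λ e → θv∉Lw (subst (_∈ L w) e (proj₁ (∈L₀ (θ∈L₀ w))))

  -- Only one colour lies in L v ∩ L w, and adjacent v, w cannot both use it.
  endpointOutside : ∀ {φ} → IsLColouring G L φ → φ v ∉ L w ⊎ φ w ∉ L v
  endpointOutside {φ} (φ-proper , φ∈L) with φ v ∈? L w | φ w ∈? L v
  ... | no φv∉ | _ = inj₁ φv∉
  ... | yes _ | no φw∉ = inj₂ φw∉
  ... | yes φv∈ | yes φw∈ = ⊥-elim (φ-proper v w gvw (commonᵛ (φ∈L v) φw∈ φv∈ (φ∈L w)))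

  toθ : ∀ {φ} → IsLColouring G L φ → LEquivalent G L φ θ
  toθ φc = [ (λ φv∉ → Pᵛ.equivalent φc θ-colouring φv∉ θv∉Lw)
           , (λ φw∉ → Pʷ.equivalent φc θ-colouring φw∉ θw∉Lv) ] (endpointOutside φc)

  fromθ : ∀ {ψ} → IsLColouring G L ψ → LEquivalent G L θ ψ
  fromθ ψc = [ (λ ψv∉ → Pᵛ.equivalent θ-colouring ψc θv∉Lw ψv∉)
             , (λ ψw∉ → Pʷ.equivalent θ-colouring ψc θw∉Lv ψw∉) ] (endpointOutside ψc)

lemma6 : (n : ℕ) (G : Adj n) → IsSimple G →
         (L : ListAssignment n) → IsDegreeAssignment G L →
         (v w : Fin n) → T (G v w) →
         Connected (deleteEdge G v w) → DegreeChoosable (deleteEdge G v w) →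
         ∣ L v ∩ L w ∣ ≤ 1 →
         LSwappable G L
lemma6 n G simple L deg v w gvw connected choosable common =
  (θ , θ-colouring) , λ _ _ φc ψc → toθ φc ◅◅ fromθ ψc
  where open ChoosableDeletion G simple L deg v w gvw connected choosable common
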